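{- Let $L$ be an $n\times n$ Z-matrix. Let $c,g\in\mathbb{Z}^n$ and $i_1,\dots,i_k\in\{1,\dots,n\}$ satisfy $c=g-\sum_{j=1}^kLe_{i_j}$. Suppose $c$ is stable and $g$ is not stable. Then for every $\ell$ with $g_\ell\ge L_{\ell\ell}$ there exists $1\le j\le k$ with $i_j=\ell$.
   Context: A Z-matrix is a real square matrix with $L_{ij}\le0$ for $i\ne j$. $e_i$ denotes the $i$-th standard basis vector of $\mathbb{R}^n$. A vector $f\in\mathbb{Z}^n$ is stable if $f_i<L_{ii}$ for all $i$, and unstable otherwise. -}

module Defs where

open import Level using (Level; suc; _⊔_)
import Data.Nat
open import Data.Nat using (ℕ)
open import Data.Fin as Fin using (Fin)
open import Data.Integer as ℤ using (ℤ)
open import Data.Product using (_×_; ∃-syntax)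
open import Data.Sum using (_⊎_)
open import Relation.Binary.PropositionalEquality using (_≡_)
open import Relation.Nullary using (¬_)
open import Algebra.Bundles using (CommutativeRing; Ring)
open import Algebra.Morphism.Structures using (IsRingHomomorphism)
import Data.Integer.Properties as ℤP

-- A totally ordered commutative ring (the paper uses the reals; Agda has none,
-- so the statement is made for every ordered commutative ring, e.g. ℝ).
record OrderedCommRing (c ℓ₁ ℓ₂ : Level) : Set (suc (c ⊔ ℓ₁ ⊔ ℓ₂)) where
  field
    commRing : CommutativeRing c ℓ₁
  open CommutativeRing commRing public
  field
    _≤_      : Carrier → Carrier → Set ℓ₂
    ≤-resp-≈ : ∀ {a b a' b'} → a ≈ a' → b ≈ b' → a ≤ b → a' ≤ b'
    ≤-refl   : ∀ {a} → a ≤ a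
    ≤-trans  : ∀ {a b d} → a ≤ b → b ≤ d → a ≤ d
    ≤-antisym : ∀ {a b} → a ≤ b → b ≤ a → a ≈ b
    ≤-total  : ∀ a b → (a ≤ b) ⊎ (b ≤ a)
    +-mono-≤ : ∀ {a b} d → a ≤ b → (a + d) ≤ (b + d)
    *-nonneg : ∀ {a b} → 0# ≤ a → 0# ≤ b → 0# ≤ (a * b)
    fromℤ    : ℤ → Carrier
    fromℤ-hom : IsRingHomomorphism (Ring.rawRing ℤP.+-*-ring) rawRing fromℤ
    fromℤ-mono : ∀ {x y} → x ℤ.≤ y → fromℤ x ≤ fromℤ y

  _<_ : Carrier → Carrier → Set (ℓ₁ ⊔ ℓ₂)
  a < b = (a ≤ b) × ¬ (a ≈ b)

module _ {c ℓ₁ ℓ₂} (R : OrderedCommRing c ℓ₁ ℓ₂) where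
  open OrderedCommRing R

  IsZMatrix : ∀ {n} → (Fin n → Fin n → Carrier) → Set (ℓ₂)
  IsZMatrix {n} L = ∀ (i j : Fin n) → ¬ (i ≡ j) → L i j ≤ 0#

  Stable : ∀ {n} → (Fin n → Fin n → Carrier) → (Fin n → ℤ) → Set (ℓ₁ ⊔ ℓ₂)
  Stable {n} L f = ∀ (i : Fin n) → fromℤ (f i) < L i i

  -- L e_i is the i-th column of L; Σ_{j=1}^k L e_{i_j}, evaluated at row r
  colSum : ∀ {n k} → (Fin n → Fin n → Carrier) → (Fin k → Fin n) → Fin n → Carrier
  colSum {k = k} L is r = sumF k (λ j → L r (is j))
    where
    sumF : (m : ℕ) → (Fin m → Carrier) → Carrier
    sumF 0 f = 0#
    sumF (Data.Nat.suc m) f = f Fin.zero + sumF m (λ j → f (Fin.suc j))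

module Submission where

open import Defs
open import Level using (Level)
open import Data.Nat using (ℕ; zero; suc)
open import Data.Fin using (Fin)
import Data.Fin as Fin
open import Data.Integer using (ℤ)
open import Data.Product using (∃-syntax; _,_)
open import Data.Sum using (_⊎_; inj₁; inj₂)
open import Relation.Binary.PropositionalEquality using (_≡_)
import Relation.Binary.PropositionalEquality as ≡
open import Relation.Nullary using (¬_; yes; no; contradiction)
open import Function using (_∘_)

-- If column ℓ never occurs among the i_j, row ℓ of Σ_j L e_{i_j} consists of
-- off-diagonal entries only, so it is ≤ 0 and c_ℓ ≥ g_ℓ ≥ L_ℓℓ, contradicting
-- the stability of c.

module OrderedCommRingProperties {a ℓ₁ ℓ₂} (R : OrderedCommRing a ℓ₁ ℓ₂) where
  open OrderedCommRing R

  x≤x-s : ∀ x {s} → s ≤ 0# → x ≤ (x - s)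
  x≤x-s x {s} s≤0 = ≤-resp-≈ (+-identityˡ x) (+-comm (- s) x) x≤-s+x
    where
    0≤-s : 0# ≤ (- s)
    0≤-s = ≤-resp-≈ (-‿inverseʳ s) (+-identityˡ (- s)) (+-mono-≤ (- s) s≤0)

    x≤-s+x : (0# + x) ≤ (- s + x)
    x≤-s+x = +-mono-≤ x 0≤-s

  ≤⇒¬< : ∀ {x y} → y ≤ x → ¬ (x < y)
  ≤⇒¬< y≤x (x≤y , x≉y) = x≉y (≤-antisym x≤y y≤x)

module _ {a ℓ₁ ℓ₂} (R : OrderedCommRing a ℓ₁ ℓ₂) {n : ℕ}
  {L : Fin n → Fin n → OrderedCommRing.Carrier R} (Z : IsZMatrix R L) where
  open OrderedCommRing R

  hit⊎colSum≤0 : ∀ {k} (is : Fin k → Fin n) ℓ →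
                 (∃[ j ] (is j ≡ ℓ)) ⊎ (colSum R L is ℓ ≤ 0#)
  hit⊎colSum≤0 {zero}  is ℓ = inj₂ ≤-refl
  hit⊎colSum≤0 {suc k} is ℓ with is Fin.zero Fin.≟ ℓ
  ... | yes i₀≡ℓ = inj₁ (Fin.zero , i₀≡ℓ)
  ... | no  i₀≢ℓ with hit⊎colSum≤0 (is ∘ Fin.suc) ℓ
  ...   | inj₁ (j , iⱼ≡ℓ) = inj₁ (Fin.suc j , iⱼ≡ℓ)
  ...   | inj₂ rest≤0     = inj₂ (≤-trans head+rest≤rest rest≤0)
    where
    head≤0 : L ℓ (is Fin.zero) ≤ 0#
    head≤0 = Z ℓ (is Fin.zero) (i₀≢ℓ ∘ ≡.sym)

    head+rest≤rest : colSum R L is ℓ ≤ colSum R L (is ∘ Fin.suc) ℓ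
    head+rest≤rest = ≤-resp-≈ refl (+-identityˡ _) (+-mono-≤ _ head≤0)

lemma4p13 : ∀ {a ℓ₁ ℓ₂ : Level} (R : OrderedCommRing a ℓ₁ ℓ₂) (n k : ℕ)
    (L : Fin n → Fin n → OrderedCommRing.Carrier R) → IsZMatrix R L →
    (c g : Fin n → ℤ) (is : Fin k → Fin n) →
    (∀ r → OrderedCommRing._≈_ R (OrderedCommRing.fromℤ R (c r))
      (OrderedCommRing._-_ R (OrderedCommRing.fromℤ R (g r)) (colSum R L is r))) →
    Stable R L c → ¬ Stable R L g →
    ∀ (ℓ : Fin n) → OrderedCommRing._≤_ R (L ℓ ℓ) (OrderedCommRing.fromℤ R (g ℓ)) →
    ∃[ j ] (is j ≡ ℓ)
lemma4p13 R n k L Z c g is c≈g-Σ c-stable _ ℓ Lℓℓ≤gℓ with hit⊎colSum≤0 R Z is ℓ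
... | inj₁ hit  = hit
... | inj₂ Σ≤0 = contradiction (c-stable ℓ) (≤⇒¬< Lℓℓ≤cℓ)
  where
  open OrderedCommRing R
  open OrderedCommRingProperties R

  Lℓℓ≤cℓ : L ℓ ℓ ≤ fromℤ (c ℓ)
  Lℓℓ≤cℓ = ≤-trans Lℓℓ≤gℓ (≤-resp-≈ refl (sym (c≈g-Σ ℓ)) (x≤x-s (fromℤ (g ℓ)) Σ≤0))
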